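{- Let $G=(V,E)$ be a graph with $V=\{1,\dots,|V|\}$, $k\ge 1$, and let ${\sf CC}$ be the program defined below. For any $k$-cliques $C_1,C_2,C_3,C_4$ of $G$, let $(a,b,c,d):=\big(CNG(C_1),\ CLG(C_2)^R,\ CLG(C_3),\ CLG(C_4)^R\big)$. Then ${\sf CC}$ generates $(a,b,c,d)$, and likewise each of its cyclic rotations $(b,c,d,a)$, $(c,d,a,b)$, $(d,a,b,c)$, if and only if each of $C_1\cup C_2$, $C_1\cup C_3$ and $C_1\cup C_4$ forms a $2k$-clique in $G$.
   Context: Graph gadgets. For $v\in V$, $\overline{v}$ is its binary representation, $N(v)$ its neighborhood, $NG(v):=\$\,\overline{v}\,\$$, $LG(v):=\bigcirc_{u\in N(v)}NG(u)$ (neighbors in a fixed order). For a $k$-clique $C$ (vertices in a fixed order), $CNG(C):=\bigcirc_{v\in C}(\#\,NG(v)\,\#)^k$ and $CLG(C):=\big(\bigcirc_{v\in C}\#\,LG(v)\,\#\big)^k$, where $x^k$ is $k$-fold concatenation, $x^R$ the reverse, $\circ$ concatenation. Tree-adjoining notions. Auxiliary trees: rooted trees with non-terminal labels on root and inner nodes, exactly one leaf (foot) carrying the root's label, other leaves terminals; inner nodes may be marked for adjunction. Adjoining auxiliary tree $a$ at a marked node $v$ of $t$ with the label of $a$'s root: replace $a$'s foot by the subtree of $t$ at $v$, then replace $v$ by the result. A normal tree with input $X$, output $Y$: auxiliary tree with root label $X$ and exactly one marked node, lying on the root-to-foot path, labeled $Y$. Its off-path terminal leaves split into (1) subtrees of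 left children along root→marked node, (2) left children along marked node→foot, (3) right children along marked node→foot, (4) right children along root→marked node; concatenating each class left to right gives the generated tuple $(n_1,n_2,n_3,n_4)$. A program ${\sf P}$ with input ${\sf P}_{In}$, output ${\sf P}_{Out}$: set of normal trees containing one with input ${\sf P}_{In}$ and one with output ${\sf P}_{Out}$; an execution is a tree obtained from a tree of ${\sf P}$ by repeatedly adjoining trees of ${\sf P}$ with input ${\sf P}_{In}$ and output ${\sf P}_{Out}$; $L({\sf P})$ is the set of tuples generated by executions; ${\sf P}$ generates a tuple if it is in $L({\sf P})$. Combination ${\sf P}\cdot{\sf Q}:={\sf P}\cup{\sf Q}''$, where ${\sf Q}''$ is ${\sf Q}$ with all non-terminals renamed to fresh copies and then the copy of ${\sf Q}_{In}$ renamed ${\sf P}_{Out}$; output is the copy of ${\sf Q}_{Out}$. Basic programs. ${\sf W}(a,b,c,d)$: one tree, root $X_{In}$ with children leaf $a$, marked node $X_{Out}$, leaf $d$; $X_{Out}$ has children leaf $b$, foot $X_{In}$, leaf $c$; ${\sf W}(x):={\sf W}(x,x,x,x)$. ${\sf Eq}(\Sigma)$: tree root $E_{In}$ → single child $E_{Out}$ (marked) → single child foot $E_{In}$; and for each $\sigma\in\Sigma$ the tree root $E_{In}$ with children leaf $\sigma$, marked node $E_{In}$, leaf $\sigma$, the marked node having children leaf $\sigma$, foot $E_{In}$, leaf $\sigma$. ${\sf A}(\Sigma)$: tree root $A_{In}$ → single child $A_{Out}$ (marked) → foot $A_{In}$; and for each $\sigma\in\Sigma$ four trees with root $A_{In}$,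 marked node $A_{In}$ on the root-to-foot path, and a single terminal leaf $\sigma$ placed as a right child of the root, a left child of the root, a left sibling of the foot, or a right sibling of the foot, respectively. ${\sf NC}:={\sf W}(\#)\cdot{\sf A}(\{0,1,\$\})\cdot{\sf W}(\$)\cdot{\sf Eq}(\{0,1\})\cdot{\sf W}(\$)\cdot{\sf A}(\{0,1,\$\})\cdot{\sf W}(\#)$, with input ${\sf NC}_{In}$ and output ${\sf NC}_{Out}$. The program ${\sf CC}$ (input ${\sf CC}_{In}$, output ${\sf CC}_{Out}$, fresh non-terminals) consists of all trees of ${\sf NC}$ together with three trees: (i) root ${\sf CC}_{In}$ with single child ${\sf NC}_{Out}$ (marked) whose single child is the foot ${\sf CC}_{In}$; (ii) root ${\sf NC}_{Out}$ with single child ${\sf NC}_{In}$ (marked) whose single child is the foot ${\sf NC}_{Out}$; (iii) root ${\sf NC}_{Out}$ with single child ${\sf CC}_{Out}$ (marked) whose single child is the foot ${\sf NC}_{Out}$. -}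

module Defs where

open import Data.Bool using (Bool; true; false; if_then_else_)
open import Data.Nat using (ℕ; zero; suc; _≤_)
open import Data.Nat.DivMod using (_/_; _%_)
open import Data.Fin using (Fin; toℕ) renaming (_<_ to _<ᶠ_)
open import Data.List using (List; []; _∷_; _++_; [_]; map; concat; concatMap; reverse; filter; length; replicate; allFin)
open import Data.List.Relation.Unary.AllPairs using (AllPairs)
open import Data.List.Relation.Unary.All using (All)
open import Data.List.Membership.Propositional using (_∈_)
open import Data.Product using (_×_; _,_; Σ; ∃)
open import Data.Sum using (_⊎_; inj₁; inj₂)
open import Data.Sum.Properties using (≡-dec)
open import Relation.Nullary using (¬_; Dec; yes; no)
open import Relation.Nullary.Decidable using (does)
open import Relation.Binary.PropositionalEquality using (_≡_; _≢_; refl)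
open import Relation.Binary.Definitions using (DecidableEquality)

data Sym : Set where
  s0 s1 dollar hash : Sym

Word : Set
Word = List Sym

_^^_ : Word → ℕ → Word
x ^^ zero  = []
x ^^ suc k = x ++ (x ^^ k)

bigcirc : {A : Set} → List A → (A → Word) → Word
bigcirc xs f = concatMap f xs

-- Graphs: vertex set V = {1,…,n}, represented by Fin n (Fin index i is
-- the vertex i+1).  Simple undirected graphs, decidable adjacency.

record Graph (n : ℕ) : Set where
  field
    adj    : Fin n → Fin n → Bool
    sym    : ∀ u v → adj u v ≡ adj v u
    irrefl : ∀ v → adj v v ≡ false
open Graph public

Adj : ∀ {n} → Graph n → Fin n → Fin n → Set
Adj G u v = adj G u v ≡ true

-- binary representation (most significant bit first, no leading zeros)
-- of a natural number; the first argument is fuel (m ≥ number suffices)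
binFuel : ℕ → ℕ → Word
binFuel zero    m       = []
binFuel (suc f) zero    = []
binFuel (suc f) (suc m) =
  binFuel f (suc m / 2) ++ [ (if does (suc m % 2 Data.Nat.≟ 0) then s0 else s1) ]

bin : ℕ → Word
bin m = binFuel m m

vbar : ∀ {n} → Fin n → Word
vbar v = bin (suc (toℕ v))

nbhd : ∀ {n} → Graph n → Fin n → List (Fin n)
nbhd {n} G v = filter (λ u → adj G v u Data.Bool.≟ true) (allFin n)

NG : ∀ {n} → Fin n → Word
NG v = dollar ∷ vbar v ++ [ dollar ]

LG : ∀ {n} → Graph n → Fin n → Word
LG G v = bigcirc (nbhd G v) NG

-- a clique is given by its list of vertices (in increasing order)
CNG : ∀ {n} → ℕ → List (Fin n) → Word
CNG k C = bigcirc C (λ v → (hash ∷ NG v ++ [ hash ]) ^^ k)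

CLG : ∀ {n} → Graph n → ℕ → List (Fin n) → Word
CLG G k C = bigcirc C (λ v → hash ∷ LG G v ++ [ hash ]) ^^ k

IsCliqueL : ∀ {n} → Graph n → List (Fin n) → Set
IsCliqueL G = AllPairs (λ u v → u ≢ v × Adj G u v)

IsKClique : ∀ {n} → Graph n → ℕ → List (Fin n) → Set
IsKClique G k C = length C ≡ k × AllPairs _<ᶠ_ C × IsCliqueL G C

-- "C ∪ D forms a 2k-clique" for k-cliques C, D: the 2k listed vertices
-- are pairwise distinct (so |C ∪ D| = 2k) and pairwise adjacent
UnionIs2kClique : ∀ {n} → Graph n → List (Fin n) → List (Fin n) → Set
UnionIs2kClique G C D = IsCliqueL G (C ++ D)

-- Normal trees (auxiliary trees with exactly one marked node, lying on
-- the root-to-foot path), written out along their spine.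

-- off-path subtrees: no foot, no marked nodes
data Plain (N : Set) : Set where
  leaf : Sym → Plain N
  node : N → List (Plain N) → Plain N

yield : ∀ {N} → Plain N → Word
yields : ∀ {N} → List (Plain N) → Word
yield (leaf σ)    = [ σ ]
yield (node _ ts) = yields ts
yields []       = []
yields (t ∷ ts) = yield t ++ yields ts

-- a node on the spine: its label, the children left of the spine
-- child and the children right of the spine child
record Step (N : Set) : Set where
  constructor step
  field
    label  : N
    lefts  : List (Plain N)
    rights : List (Plain N)
open Step public

-- upper : nodes strictly above the marked node, from the root downwards
-- mark  : the marked node
-- lower : nodes strictly between the marked node and the foot, downwards
-- footL : label of the foot
record NTree (N : Set) : Set where
  constructor ntree
  field
    upper : List (Step N)
    mark  : Step N
    lower : List (Step N)
    footL : N
open NTree public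

rootLabel : ∀ {N} → NTree N → N
rootLabel t with upper t
... | []    = label (mark t)
... | s ∷ _ = label s

IsAux : ∀ {N} → NTree N → Set
IsAux t = footL t ≡ rootLabel t

input output : ∀ {N} → NTree N → N
input  = rootLabel
output t = label (mark t)

Tuple : Set
Tuple = Word × Word × Word × Word

tuple : ∀ {N} → NTree N → Tuple
tuple t =
  ( concatMap (λ s → yields (lefts s)) (upper t)
  , concatMap (λ s → yields (lefts s)) (mark t ∷ lower t)
  , concatMap (λ s → yields (rights s)) (reverse (mark t ∷ lower t))
  , concatMap (λ s → yields (rights s)) (reverse (upper t)) )

-- adjoining a (root label = label of marked node of t) at the marked node
-- of t: a's foot is replaced by the subtree of t at the marked node (which
-- thereby becomes an ordinary, unmarked node, as the foot was), and the
-- marked node of the result is the marked node of a.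
adjoin : ∀ {N} → NTree N → NTree N → NTree N
adjoin t a = ntree (upper t ++ upper a) (mark a)
                   (lower a ++ (mark t ∷ lower t)) (footL t)

mapPlain : ∀ {N M} → (N → M) → Plain N → Plain M
mapPlains : ∀ {N M} → (N → M) → List (Plain N) → List (Plain M)
mapPlain f (leaf σ)    = leaf σ
mapPlain f (node x ts) = node (f x) (mapPlains f ts)
mapPlains f []       = []
mapPlains f (t ∷ ts) = mapPlain f t ∷ mapPlains f ts

mapStep : ∀ {N M} → (N → M) → Step N → Step M
mapStep f (step l ls rs) = step (f l) (mapPlains f ls) (mapPlains f rs)

mapTree : ∀ {N M} → (N → M) → NTree N → NTree M
mapTree f (ntree u m l x) = ntree (map (mapStep f) u) (mapStep f m) (map (mapStep f) l) (f x)

record Program (N : Set) : Set where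
  constructor program
  field
    trees : List (NTree N)
    In    : N
    Out   : N
open Program public

data Exec {N : Set} (P : Program N) : NTree N → Set where
  start : ∀ {t} → t ∈ trees P → Exec P t
  adjn  : ∀ {t a} → Exec P t → a ∈ trees P →
          rootLabel a ≡ label (mark t) → Exec P (adjoin t a)

IsExecution : ∀ {N} → Program N → NTree N → Set
IsExecution P t = Exec P t × input t ≡ In P × output t ≡ Out P

Generates : ∀ {N} → Program N → Tuple → Set
Generates P x = ∃ λ t → IsExecution P t × tuple t ≡ x

-- combination P · Q : non-terminals of Q become fresh copies (inj₂),
-- except the copy of Q_In, which is renamed P_Out.
renQ : ∀ {N M : Set} → DecidableEquality M → N → M → M → N ⊎ M
renQ _≟M_ pout qin m with m ≟M qin
... | yes _ = inj₁ pout
... | no  _ = inj₂ m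

infixl 5 _·⟨_⟩_
_·⟨_⟩_ : ∀ {N M : Set} → Program N → DecidableEquality M → Program M → Program (N ⊎ M)
P ·⟨ d ⟩ Q = program
  (map (mapTree inj₁) (trees P) ++ map (mapTree (renQ d (Out P) (In Q))) (trees Q))
  (inj₁ (In P))
  (renQ d (Out P) (In Q) (Out Q))

data IO : Set where
  I O : IO

_≟IO_ : DecidableEquality IO
I ≟IO I = yes refl
I ≟IO O = no (λ ())
O ≟IO I = no (λ ())
O ≟IO O = yes refl

W4 : Sym → Sym → Sym → Sym → Program IO
W4 a b c d = program
  [ ntree [ step I [ leaf a ] [ leaf d ] ] (step O [ leaf b ] [ leaf c ]) [] I ]
  I O

W : Sym → Program IO
W x = W4 x x x x

Eq : List Sym → Program IO
Eq Σ = program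
  (ntree [ step I [] [] ] (step O [] []) [] I
   ∷ map (λ σ → ntree [ step I [ leaf σ ] [ leaf σ ] ] (step I [ leaf σ ] [ leaf σ ]) [] I) Σ)
  I O

A : List Sym → Program IO
A Σ = program
  (ntree [ step I [] [] ] (step O [] []) [] I
   ∷ concatMap (λ σ →
       ntree [ step I [] [ leaf σ ] ] (step I [] []) [] I   -- right child of root
     ∷ ntree [ step I [ leaf σ ] [] ] (step I [] []) [] I   -- left child of root
     ∷ ntree [ step I [] [] ] (step I [ leaf σ ] []) [] I   -- left sibling of foot
     ∷ ntree [ step I [] [] ] (step I [] [ leaf σ ]) [] I   -- right sibling of foot
     ∷ []) Σ)
  I O

NCLab : Set
NCLab = (((((IO ⊎ IO) ⊎ IO) ⊎ IO) ⊎ IO) ⊎ IO) ⊎ IO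

NC : Program NCLab
NC = W hash ·⟨ _≟IO_ ⟩ A (s0 ∷ s1 ∷ dollar ∷ [])
            ·⟨ _≟IO_ ⟩ W dollar
            ·⟨ _≟IO_ ⟩ Eq (s0 ∷ s1 ∷ [])
            ·⟨ _≟IO_ ⟩ W dollar
            ·⟨ _≟IO_ ⟩ A (s0 ∷ s1 ∷ dollar ∷ [])
            ·⟨ _≟IO_ ⟩ W hash

CC : Program (NCLab ⊎ IO)
CC = program
  (map (mapTree inj₁) (trees NC)
   ++ ntree [ step ccIn [] [] ] (step ncOut [] []) [] ccIn
   ∷ ntree [ step ncOut [] [] ] (step ncIn [] []) [] ncOut
   ∷ ntree [ step ncOut [] [] ] (step ccOut [] []) [] ncOut
   ∷ [])
  ccIn ccOut
  where
    ccIn ccOut ncIn ncOut : NCLab ⊎ IO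
    ccIn  = inj₂ I
    ccOut = inj₂ O
    ncIn  = inj₁ (In NC)
    ncOut = inj₁ (Out NC)

-- Straightening a tuple (reversing its second and fourth component) turns
-- adjunction into componentwise concatenation. Read this way, every pass through
-- NC appends one block #x₁#, …, #x₄# to the four components in which the xᵢ
-- share a common $-delimited binary word, so CC generates exactly the tuples
-- whose straightening is a concatenation of such blocks; this language is
-- invariant under rotating and reversing all four components. In
-- CNG(C₁), CLG(C₂), CLG(C₃), CLG(C₄) the blocks line up as #NG(v)# against
-- #LG(x)#, #LG(y)#, #LG(z)# for v ∈ C₁ and x, y, z running through C₂, C₃, C₄;
-- the only binary word in NG(v) is v̄, and v̄ occurs in LG(x) iff x ~ v. Hence the
-- tuple is generated iff every vertex of C₁ is adjacent to all of C₂, C₃, C₄.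
module Submission where

open import Data.Bool using (true; if_then_else_) renaming (_≟_ to _≟ᵇ_)
open import Data.Empty using (⊥; ⊥-elim)
open import Data.Fin using (Fin; toℕ; #_)
open import Data.Fin.Properties using (toℕ-injective)
open import Data.List using (List; []; _∷_; _∷ʳ_; _++_; [_]; map; concat; concatMap; reverse; length; replicate; lookup; foldl; allFin)
open import Data.List.Properties
  using (++-assoc; ++-identityʳ; ∷-injective; ∷-injectiveˡ; ∷-injectiveʳ; reverse-++; unfold-reverse; ʳ++-defn; reverse-involutive; concatMap-++; foldl-++; concatMap-map; length-map; length-replicate)
open import Data.List.Membership.Propositional using (_∈_)
open import Data.List.Membership.Propositional.Properties using (∈-lookup; ∈-filter⁺; ∈-filter⁻; ∈-allFin; ∈-∃++)
open import Data.List.Relation.Unary.All as All using (All; []; _∷_)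
import Data.List.Relation.Unary.All.Properties as All
open import Data.List.Relation.Unary.AllPairs using ([]; _∷_)
import Data.List.Relation.Unary.AllPairs.Properties as AllPairs
open import Data.List.Relation.Unary.Any using (here; there)
import Data.List.Relation.Unary.Any.Properties as Any
open import Data.Nat using (ℕ; zero; suc; _+_; _*_; _≤_; _<_; z≤n; s≤s; _≟_)
open import Data.Nat.DivMod using (_/_; _%_; m≡m%n+[m/n]*n; m/n<m; m%n<n)
open import Data.Nat.Properties using (+-comm; ≤-refl; ≤-trans; ≤-pred; suc-injective)
open import Data.Product using (_×_; _,_; ∃; ∃₂; proj₁; proj₂)
open import Data.Sum using (_⊎_; inj₁; inj₂)
open import Data.Product.Function.NonDependent.Propositional using (_×-⇔_)
open import Function.Bundles using (_⇔_; mk⇔)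
open import Function.Properties.Equivalence using (⇔-setoid)
open import Function using (_∘_; case_of_)
open import Level using (0ℓ)
open import Relation.Binary.PropositionalEquality using (_≡_; _≢_; refl; sym; trans; cong; cong₂; subst; module ≡-Reasoning)
open import Relation.Nullary using (Dec; yes; no; does)
open import Relation.Nullary.Decidable using (toWitness)
import Relation.Binary.Reasoning.Setoid as SetoidReasoning

open import Defs hiding (sym)

-- Quadruples of words

infixr 5 _⊕_

_⊕_ : Tuple → Tuple → Tuple
(a₁ , a₂ , a₃ , a₄) ⊕ (b₁ , b₂ , b₃ , b₄) = a₁ ++ b₁ , a₂ ++ b₂ , a₃ ++ b₃ , a₄ ++ b₄

ε : Tuple
ε = [] , [] , [] , []

map₄ : (Word → Word) → Tuple → Tuple
map₄ f (a₁ , a₂ , a₃ , a₄) = f a₁ , f a₂ , f a₃ , f a₄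

zip₄ : (Word → Word → Word) → Tuple → Tuple → Tuple
zip₄ f (a₁ , a₂ , a₃ , a₄) (b₁ , b₂ , b₃ , b₄) = f a₁ b₁ , f a₂ b₂ , f a₃ b₃ , f a₄ b₄

diag : Word → Tuple
diag w = w , w , w , w

at₁ at₂ at₃ at₄ : Sym → Tuple
at₁ σ = [ σ ] , [] , [] , []
at₂ σ = [] , [ σ ] , [] , []
at₃ σ = [] , [] , [ σ ] , []
at₄ σ = [] , [] , [] , [ σ ]

cong₄ : ∀ {a₁ a₂ a₃ a₄ b₁ b₂ b₃ b₄ : Word} →
        a₁ ≡ b₁ → a₂ ≡ b₂ → a₃ ≡ b₃ → a₄ ≡ b₄ → (a₁ , a₂ , a₃ , a₄) ≡ (b₁ , b₂ , b₃ , b₄)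
cong₄ refl refl refl refl = refl

,-injective₄ : ∀ {a₁ a₂ a₃ a₄ b₁ b₂ b₃ b₄ : Word} → (a₁ , a₂ , a₃ , a₄) ≡ (b₁ , b₂ , b₃ , b₄) →
               a₁ ≡ b₁ × a₂ ≡ b₂ × a₃ ≡ b₃ × a₄ ≡ b₄
,-injective₄ refl = refl , refl , refl , refl

⊕-assoc : ∀ x y z → (x ⊕ y) ⊕ z ≡ x ⊕ (y ⊕ z)
⊕-assoc (a₁ , a₂ , a₃ , a₄) (b₁ , b₂ , b₃ , b₄) (c₁ , c₂ , c₃ , c₄) =
  cong₄ (++-assoc a₁ b₁ c₁) (++-assoc a₂ b₂ c₂) (++-assoc a₃ b₃ c₃) (++-assoc a₄ b₄ c₄)

⊕-identityʳ : ∀ x → x ⊕ ε ≡ x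
⊕-identityʳ (a₁ , a₂ , a₃ , a₄) = cong₄ (++-identityʳ a₁) (++-identityʳ a₂) (++-identityʳ a₃) (++-identityʳ a₄)

straighten : Tuple → Tuple
straighten (a₁ , a₂ , a₃ , a₄) = a₁ , reverse a₂ , a₃ , reverse a₄

straighten-involutive : ∀ x → straighten (straighten x) ≡ x
straighten-involutive (a₁ , a₂ , a₃ , a₄) = cong₄ refl (reverse-involutive a₂) refl (reverse-involutive a₄)

straighten-injective : ∀ {x y} → straighten x ≡ straighten y → x ≡ y
straighten-injective {x} {y} eq =
  trans (sym (straighten-involutive x)) (trans (cong straighten eq) (straighten-involutive y))

rotate : Tuple → Tuple
rotate (a₁ , a₂ , a₃ , a₄) = a₄ , a₁ , a₂ , a₃

reverse₄ : Tuple → Tuple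
reverse₄ = map₄ reverse

reverse₄-involutive : ∀ x → reverse₄ (reverse₄ x) ≡ x
reverse₄-involutive (a₁ , a₂ , a₃ , a₄) =
  cong₄ (reverse-involutive a₁) (reverse-involutive a₂) (reverse-involutive a₃) (reverse-involutive a₄)

reverse₄-⊕ : ∀ x y → reverse₄ (x ⊕ y) ≡ reverse₄ y ⊕ reverse₄ x
reverse₄-⊕ (a₁ , a₂ , a₃ , a₄) (b₁ , b₂ , b₃ , b₄) =
  cong₄ (reverse-++ a₁ b₁) (reverse-++ a₂ b₂) (reverse-++ a₃ b₃) (reverse-++ a₄ b₄)

infix 4 _─[_]→_
infixr 9 _⨾_

-- A record rather than a function type, so that P, d and Q can be inferred.
record _─[_]→_ (P : Tuple → Set) (d : Tuple) (Q : Tuple → Set) : Set where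
  constructor extend
  field apply : ∀ {u} → P u → Q (u ⊕ d)
open _─[_]→_ public

_⨾_ : ∀ {P Q R d e} → P ─[ d ]→ Q → Q ─[ e ]→ R → P ─[ d ⊕ e ]→ R
_⨾_ {R = R} {d} {e} f g = extend λ {u} p → subst R (⊕-assoc u d e) (apply g (apply f p))

stay : ∀ {P} → P ─[ ε ]→ P
stay {P} = extend λ {u} p → subst P (sym (⊕-identityʳ u)) p

retarget : ∀ {P Q d e} → d ≡ e → P ─[ d ]→ Q → P ─[ e ]→ Q
retarget refl f = f

loop-diag : ∀ {P} {R : Sym → Set} → (∀ {σ} → R σ → P ─[ diag [ σ ] ]→ P) →
            ∀ {w} → All R w → P ─[ diag w ]→ P
loop-diag one []       = stay
loop-diag one (r ∷ rs) = one r ⨾ loop-diag one rs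

loop-components : ∀ {P} {R : Sym → Set} →
  (∀ {σ} → R σ → P ─[ at₁ σ ]→ P) → (∀ {σ} → R σ → P ─[ at₂ σ ]→ P) →
  (∀ {σ} → R σ → P ─[ at₃ σ ]→ P) → (∀ {σ} → R σ → P ─[ at₄ σ ]→ P) →
  ∀ {a₁ a₂ a₃ a₄} → All R a₁ → All R a₂ → All R a₃ → All R a₄ → P ─[ (a₁ , a₂ , a₃ , a₄) ]→ P
loop-components f₁ f₂ f₃ f₄ (r ∷ rs) r₂ r₃ r₄ = f₁ r ⨾ loop-components f₁ f₂ f₃ f₄ rs r₂ r₃ r₄
loop-components f₁ f₂ f₃ f₄ [] (r ∷ rs) r₃ r₄ = f₂ r ⨾ loop-components f₁ f₂ f₃ f₄ [] rs r₃ r₄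
loop-components f₁ f₂ f₃ f₄ [] [] (r ∷ rs) r₄ = f₃ r ⨾ loop-components f₁ f₂ f₃ f₄ [] [] rs r₄
loop-components f₁ f₂ f₃ f₄ [] [] [] (r ∷ rs) = f₄ r ⨾ loop-components f₁ f₂ f₃ f₄ [] [] [] rs
loop-components f₁ f₂ f₃ f₄ [] [] [] []       = stay

straighten-adjoin : ∀ {N} (t a : NTree N) →
                    straighten (tuple (adjoin t a)) ≡ straighten (tuple t) ⊕ straighten (tuple a)
straighten-adjoin (ntree uₜ mₜ lₜ _) (ntree uₐ mₐ lₐ _) = cong₄
  (concatMap-++ left uₜ uₐ)
  (begin
    reverse (concatMap left ((mₐ ∷ lₐ) ++ (mₜ ∷ lₜ)))
      ≡⟨ cong reverse (concatMap-++ left (mₐ ∷ lₐ) (mₜ ∷ lₜ)) ⟩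
    reverse (concatMap left (mₐ ∷ lₐ) ++ concatMap left (mₜ ∷ lₜ))
      ≡⟨ reverse-++ (concatMap left (mₐ ∷ lₐ)) (concatMap left (mₜ ∷ lₜ)) ⟩
    reverse (concatMap left (mₜ ∷ lₜ)) ++ reverse (concatMap left (mₐ ∷ lₐ)) ∎)
  (begin
    concatMap right (reverse ((mₐ ∷ lₐ) ++ (mₜ ∷ lₜ)))
      ≡⟨ cong (concatMap right) (reverse-++ (mₐ ∷ lₐ) (mₜ ∷ lₜ)) ⟩
    concatMap right (reverse (mₜ ∷ lₜ) ++ reverse (mₐ ∷ lₐ))
      ≡⟨ concatMap-++ right (reverse (mₜ ∷ lₜ)) (reverse (mₐ ∷ lₐ)) ⟩
    concatMap right (reverse (mₜ ∷ lₜ)) ++ concatMap right (reverse (mₐ ∷ lₐ)) ∎)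
  (begin
    reverse (concatMap right (reverse (uₜ ++ uₐ)))
      ≡⟨ cong (reverse ∘ concatMap right) (reverse-++ uₜ uₐ) ⟩
    reverse (concatMap right (reverse uₐ ++ reverse uₜ))
      ≡⟨ cong reverse (concatMap-++ right (reverse uₐ) (reverse uₜ)) ⟩
    reverse (concatMap right (reverse uₐ) ++ concatMap right (reverse uₜ))
      ≡⟨ reverse-++ (concatMap right (reverse uₐ)) (concatMap right (reverse uₜ)) ⟩
    reverse (concatMap right (reverse uₜ)) ++ reverse (concatMap right (reverse uₐ)) ∎)
  where
  open ≡-Reasoning
  left right : Step _ → Word
  left s = yields (lefts s)
  right s = yields (rights s)

HasUpper : ∀ {N} → NTree N → Set
HasUpper t = ∃₂ λ s r → upper t ≡ s ∷ r

adjoin-hasUpper : ∀ {N} (t a : NTree N) → HasUpper t → HasUpper (adjoin t a)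
adjoin-hasUpper _ a (s , r , eq) = s , r ++ upper a , cong (_++ upper a) eq

rootLabel-adjoin : ∀ {N} (t a : NTree N) → HasUpper t → rootLabel (adjoin t a) ≡ rootLabel t
rootLabel-adjoin (ntree _ _ _ _) a (_ , _ , refl) = refl

-- The language generated by CC

data Bit : Sym → Set where
  bit0 : Bit s0
  bit1 : Bit s1

data Filler : Sym → Set where
  fill0 : Filler s0
  fill1 : Filler s1
  fill$ : Filler dollar

Bits Fillers : Word → Set
Bits    = All Bit
Fillers = All Filler

Fillers₄ : Tuple → Set
Fillers₄ (a₁ , a₂ , a₃ , a₄) = Fillers a₁ × Fillers a₂ × Fillers a₃ × Fillers a₄

at₁-fillers : ∀ {σ} → Filler σ → Fillers₄ (at₁ σ)
at₁-fillers f = f ∷ [] , [] , [] , []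

at₂-fillers : ∀ {σ} → Filler σ → Fillers₄ (at₂ σ)
at₂-fillers f = [] , f ∷ [] , [] , []

at₃-fillers : ∀ {σ} → Filler σ → Fillers₄ (at₃ σ)
at₃-fillers f = [] , [] , f ∷ [] , []

at₄-fillers : ∀ {σ} → Filler σ → Fillers₄ (at₄ σ)
at₄-fillers f = [] , [] , [] , f ∷ []

Occurs : Word → Word → Set
Occurs w x = ∃₂ λ α β → Fillers α × Fillers β × x ≡ α ++ dollar ∷ w ++ dollar ∷ β

SharesCode : Tuple → Set
SharesCode (x₁ , x₂ , x₃ , x₄) =
  ∃ λ w → Bits w × Occurs w x₁ × Occurs w x₂ × Occurs w x₃ × Occurs w x₄

framed : Word → Word
framed x = hash ∷ x ++ [ hash ]

concatFramed : List Tuple → Tuple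
concatFramed []      = ε
concatFramed (q ∷ Q) = map₄ framed q ⊕ concatFramed Q

concatFramed-++ : ∀ Q R → concatFramed (Q ++ R) ≡ concatFramed Q ⊕ concatFramed R
concatFramed-++ []      R = refl
concatFramed-++ (q ∷ Q) R = begin
  map₄ framed q ⊕ concatFramed (Q ++ R)             ≡⟨ cong (map₄ framed q ⊕_) (concatFramed-++ Q R) ⟩
  map₄ framed q ⊕ concatFramed Q ⊕ concatFramed R   ≡⟨ ⊕-assoc (map₄ framed q) (concatFramed Q) (concatFramed R) ⟨
  (map₄ framed q ⊕ concatFramed Q) ⊕ concatFramed R ∎
  where open ≡-Reasoning

Blocks : Tuple → Set
Blocks u = ∃ λ Q → All SharesCode Q × u ≡ concatFramed Q

-- While one pass of NC writes a block #α$w$β#, the unfinished block has one of these shapes.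
openPrefix : Word → Word
openPrefix α = hash ∷ α

openCode : Word → Word → Word
openCode w α = hash ∷ α ++ dollar ∷ w

openSuffix : Word → Word → Word → Word
openSuffix w α β = hash ∷ α ++ dollar ∷ w ++ dollar ∷ β

InPrefix InCode InSuffix : Tuple → Set
InPrefix p = ∃ λ αs → Fillers₄ αs × p ≡ map₄ openPrefix αs
InCode   p = ∃₂ λ αs w → Fillers₄ αs × Bits w × p ≡ map₄ (openCode w) αs
InSuffix p = ∃₂ λ αs w → ∃ λ βs → Fillers₄ αs × Bits w × Fillers₄ βs × p ≡ zip₄ (openSuffix w) αs βs

WithOpenBlock : (Tuple → Set) → Tuple → Set
WithOpenBlock S u = ∃ λ Q → All SharesCode Q × ∃ λ p → S p × u ≡ concatFramed Q ⊕ p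

Fillers₄-⊕ : ∀ x y → Fillers₄ x → Fillers₄ y → Fillers₄ (x ⊕ y)
Fillers₄-⊕ _ _ (f₁ , f₂ , f₃ , f₄) (g₁ , g₂ , g₃ , g₄) =
  All.++⁺ f₁ g₁ , All.++⁺ f₂ g₂ , All.++⁺ f₃ g₃ , All.++⁺ f₄ g₄

openCode-snoc : ∀ w α v → openCode w α ++ v ≡ openCode (w ++ v) α
openCode-snoc w α v = cong (hash ∷_) (++-assoc α (dollar ∷ w) v)

openSuffix-snoc : ∀ w α β v → openSuffix w α β ++ v ≡ openSuffix w α (β ++ v)
openSuffix-snoc w α β v = cong (hash ∷_) (begin
  (α ++ dollar ∷ w ++ dollar ∷ β) ++ v ≡⟨ ++-assoc α _ v ⟩
  α ++ dollar ∷ (w ++ dollar ∷ β) ++ v ≡⟨ cong (λ z → α ++ dollar ∷ z) (++-assoc w _ v) ⟩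
  α ++ dollar ∷ w ++ dollar ∷ β ++ v ∎)
  where open ≡-Reasoning

open-block : Blocks ─[ diag [ hash ] ]→ WithOpenBlock InPrefix
open-block = extend λ { (Q , sc , refl) → Q , sc , _ , (ε , ([] , [] , [] , []) , refl) , refl }

extend-open : ∀ {S S′ d} → S ─[ d ]→ S′ → WithOpenBlock S ─[ d ]→ WithOpenBlock S′
extend-open {d = d} f = extend λ { (Q , sc , p , s , refl) → Q , sc , p ⊕ d , apply f s , ⊕-assoc (concatFramed Q) p d }

prefix-fillers : ∀ {c} → Fillers₄ c → InPrefix ─[ c ]→ InPrefix
prefix-fillers {c} fc = extend λ { (αs@(_ , _ , _ , _) , fs , refl) → αs ⊕ c , Fillers₄-⊕ αs c fs fc , refl }

prefix-end : InPrefix ─[ diag [ dollar ] ]→ InCode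
prefix-end = extend λ { ((_ , _ , _ , _) , fs , refl) → _ , [] , fs , [] , refl }

code-bit : ∀ {σ} → Bit σ → InCode ─[ diag [ σ ] ]→ InCode
code-bit {σ} b = extend λ { ((α₁ , α₂ , α₃ , α₄) , w , fs , bs , refl) →
  _ , w ++ [ σ ] , fs , All.++⁺ bs (b ∷ []) ,
  cong₄ (openCode-snoc w α₁ _) (openCode-snoc w α₂ _) (openCode-snoc w α₃ _) (openCode-snoc w α₄ _) }

code-end : InCode ─[ diag [ dollar ] ]→ InSuffix
code-end = extend λ { ((α₁ , α₂ , α₃ , α₄) , w , fs , bs , refl) →
  _ , w , ε , fs , bs , ([] , [] , [] , []) ,
  cong₄ (openCode-snoc w α₁ _) (openCode-snoc w α₂ _) (openCode-snoc w α₃ _) (openCode-snoc w α₄ _) }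

suffix-fillers : ∀ {c} → Fillers₄ c → InSuffix ─[ c ]→ InSuffix
suffix-fillers {c@(c₁ , c₂ , c₃ , c₄)} fc = extend λ
  { ((α₁ , α₂ , α₃ , α₄) , w , βs@(β₁ , β₂ , β₃ , β₄) , fs , bs , gs , refl) →
    _ , w , βs ⊕ c , fs , bs , Fillers₄-⊕ βs c gs fc ,
    cong₄ (openSuffix-snoc w α₁ β₁ c₁) (openSuffix-snoc w α₂ β₂ c₂)
          (openSuffix-snoc w α₃ β₃ c₃) (openSuffix-snoc w α₄ β₄ c₄) }

close-block : WithOpenBlock InSuffix ─[ diag [ hash ] ]→ Blocks
close-block = extend λ
  { (Q , sc , _ , ((α₁ , α₂ , α₃ , α₄) , w , (β₁ , β₂ , β₃ , β₄) , (f₁ , f₂ , f₃ , f₄) , bs , (g₁ , g₂ , g₃ , g₄) , refl) , refl) →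
    let q = (α₁ ++ dollar ∷ w ++ dollar ∷ β₁ , α₂ ++ dollar ∷ w ++ dollar ∷ β₂ ,
             α₃ ++ dollar ∷ w ++ dollar ∷ β₃ , α₄ ++ dollar ∷ w ++ dollar ∷ β₄)
        shares : SharesCode q
        shares = w , bs , (_ , _ , f₁ , g₁ , refl) , (_ , _ , f₂ , g₂ , refl) ,
                          (_ , _ , f₃ , g₃ , refl) , (_ , _ , f₄ , g₄ , refl)
    in Q ++ [ q ] , All.++⁺ sc (shares ∷ []) , (begin
      (concatFramed Q ⊕ _) ⊕ diag [ hash ]  ≡⟨ ⊕-assoc (concatFramed Q) _ _ ⟩
      concatFramed Q ⊕ map₄ framed q        ≡⟨ cong (concatFramed Q ⊕_) (⊕-identityʳ (map₄ framed q)) ⟨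
      concatFramed Q ⊕ concatFramed [ q ]   ≡⟨ concatFramed-++ Q [ q ] ⟨
      concatFramed (Q ++ [ q ])             ∎) }
  where open ≡-Reasoning

-- The labels of CC that can carry the marked node: the inputs and outputs of
-- NC and CC and the outputs of the seven components W(#), A, W($), Eq, W($),
-- A, W(#) of NC (the output of each is the input of the next).
pattern ccIn       = inj₂ I
pattern ccOut      = inj₂ O
pattern ncIn       = inj₁ (inj₁ (inj₁ (inj₁ (inj₁ (inj₁ (inj₁ I))))))
pattern prefixLoop = inj₁ (inj₁ (inj₁ (inj₁ (inj₁ (inj₁ (inj₁ O))))))
pattern prefixDone = inj₁ (inj₁ (inj₁ (inj₁ (inj₁ (inj₁ (inj₂ O))))))
pattern codeLoop   = inj₁ (inj₁ (inj₁ (inj₁ (inj₁ (inj₂ O)))))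
pattern codeDone   = inj₁ (inj₁ (inj₁ (inj₁ (inj₂ O))))
pattern suffixLoop = inj₁ (inj₁ (inj₁ (inj₂ O)))
pattern suffixDone = inj₁ (inj₁ (inj₂ O))
pattern ncOut      = inj₁ (inj₂ O)

-- The invariant: an execution prefix started at CC_In whose marked node is
-- labelled X has its straightened tuple in Stage X.
Stage : NCLab ⊎ IO → Tuple → Set
Stage ccIn       = Blocks
Stage ncIn       = Blocks
Stage prefixLoop = WithOpenBlock InPrefix
Stage prefixDone = WithOpenBlock InPrefix
Stage codeLoop   = WithOpenBlock InCode
Stage codeDone   = WithOpenBlock InCode
Stage suffixLoop = WithOpenBlock InSuffix
Stage suffixDone = WithOpenBlock InSuffix
Stage ncOut      = Blocks
Stage ccOut      = Blocks
Stage _          = λ _ → ⊥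

StageStep : NTree (NCLab ⊎ IO) → Set
StageStep t = Stage (rootLabel t) ─[ straighten (tuple t) ]→ Stage (output t)

-- In each of A(Σ) the four trees per letter σ put σ into the components
-- 4, 1, 2, 3 of the generated tuple.
stageSteps : All StageStep (trees CC)
stageSteps =
    open-block
  ∷ stay
  ∷ prefix at₄-fillers fill0 ∷ prefix at₁-fillers fill0 ∷ prefix at₂-fillers fill0 ∷ prefix at₃-fillers fill0
  ∷ prefix at₄-fillers fill1 ∷ prefix at₁-fillers fill1 ∷ prefix at₂-fillers fill1 ∷ prefix at₃-fillers fill1
  ∷ prefix at₄-fillers fill$ ∷ prefix at₁-fillers fill$ ∷ prefix at₂-fillers fill$ ∷ prefix at₃-fillers fill$
  ∷ extend-open prefix-end
  ∷ stay
  ∷ extend-open (code-bit bit0) ∷ extend-open (code-bit bit1)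
  ∷ extend-open code-end
  ∷ stay
  ∷ suffix at₄-fillers fill0 ∷ suffix at₁-fillers fill0 ∷ suffix at₂-fillers fill0 ∷ suffix at₃-fillers fill0
  ∷ suffix at₄-fillers fill1 ∷ suffix at₁-fillers fill1 ∷ suffix at₂-fillers fill1 ∷ suffix at₃-fillers fill1
  ∷ suffix at₄-fillers fill$ ∷ suffix at₁-fillers fill$ ∷ suffix at₂-fillers fill$ ∷ suffix at₃-fillers fill$
  ∷ close-block
  ∷ stay ∷ stay ∷ stay
  ∷ []
  where
  prefix suffix : ∀ {x σ} → (Filler σ → Fillers₄ x) → Filler σ → _ ─[ x ]→ _
  prefix fillers f = extend-open (prefix-fillers (fillers f))
  suffix fillers f = extend-open (suffix-fillers (fillers f))

hasUpper? : ∀ {N} (t : NTree N) → Dec (HasUpper t)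
hasUpper? (ntree []      _ _ _) = no λ ()
hasUpper? (ntree (s ∷ r) _ _ _) = yes (s , r , refl)

trees-hasUpper : All HasUpper (trees CC)
trees-hasUpper = toWitness {a? = All.all? hasUpper? (trees CC)} _

exec-hasUpper : ∀ {t} → Exec CC t → HasUpper t
exec-hasUpper (start t∈) = All.lookup trees-hasUpper t∈
exec-hasUpper (adjn {t} {a} e _ _) = adjoin-hasUpper t a (exec-hasUpper e)

exec-stage : ∀ {t} → Exec CC t → Stage (rootLabel t) ε → Stage (output t) (straighten (tuple t))
exec-stage (start t∈) s = apply (All.lookup stageSteps t∈) s
exec-stage (adjn {t} {a} e a∈ a↑t) s =
  subst (Stage (output a)) (sym (straighten-adjoin t a))
    (apply (All.lookup stageSteps a∈)
      (subst (λ X → Stage X _) (sym a↑t)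
        (exec-stage e (subst (λ X → Stage X ε) (rootLabel-adjoin t a (exec-hasUpper e)) s))))

generates⇒Blocks : ∀ {x} → Generates CC x → Blocks (straighten x)
generates⇒Blocks (t , (e , t-in , t-out) , refl) =
  subst (λ X → Stage X (straighten (tuple t))) t-out (exec-stage e (subst (λ X → Stage X ε) (sym t-in) ([] , [] , refl)))

Reachable : NCLab ⊎ IO → Tuple → Set
Reachable X u = ∃ λ t → Exec CC t × rootLabel t ≡ ccIn × output t ≡ X × straighten (tuple t) ≡ u

-- Trees of CC by position: W(#) is 0, A(Σ) is 1–13, W($) is 14, Eq is 15–17,
-- W($) is 18, A(Σ) is 19–31, W(#) is 32 and the three trees of CC are 33–35.
tree : Fin (length (trees CC)) → NTree (NCLab ⊎ IO)
tree = lookup (trees CC)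

via : ∀ i → Reachable (rootLabel (tree i)) ─[ straighten (tuple (tree i)) ]→ Reachable (output (tree i))
via i = extend λ { (t , e , t-in , refl , refl) →
  adjoin t (tree i) , adjn e (∈-lookup i) refl ,
  trans (rootLabel-adjoin t (tree i) (exec-hasUpper e)) t-in , refl , straighten-adjoin t (tree i) }

reach-start : Reachable ncOut ε
reach-start = tree (# 33) , start (∈-lookup (# 33)) , refl , refl , refl

prefix-loop : ∀ {c} → Fillers₄ c → Reachable prefixLoop ─[ c ]→ Reachable prefixLoop
prefix-loop (f₁ , f₂ , f₃ , f₄) = loop-components
  (λ { fill0 → via (# 3) ; fill1 → via (# 7) ; fill$ → via (# 11) })
  (λ { fill0 → via (# 4) ; fill1 → via (# 8) ; fill$ → via (# 12) })
  (λ { fill0 → via (# 5) ; fill1 → via (# 9) ; fill$ → via (# 13) })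
  (λ { fill0 → via (# 2) ; fill1 → via (# 6) ; fill$ → via (# 10) })
  f₁ f₂ f₃ f₄

code-loop : ∀ {w} → Bits w → Reachable codeLoop ─[ diag w ]→ Reachable codeLoop
code-loop = loop-diag λ { bit0 → via (# 16) ; bit1 → via (# 17) }

suffix-loop : ∀ {c} → Fillers₄ c → Reachable suffixLoop ─[ c ]→ Reachable suffixLoop
suffix-loop (f₁ , f₂ , f₃ , f₄) = loop-components
  (λ { fill0 → via (# 21) ; fill1 → via (# 25) ; fill$ → via (# 29) })
  (λ { fill0 → via (# 22) ; fill1 → via (# 26) ; fill$ → via (# 30) })
  (λ { fill0 → via (# 23) ; fill1 → via (# 27) ; fill$ → via (# 31) })
  (λ { fill0 → via (# 20) ; fill1 → via (# 24) ; fill$ → via (# 28) })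
  f₁ f₂ f₃ f₄

reach-block : ∀ {q} → SharesCode q → Reachable ncOut ─[ map₄ framed q ]→ Reachable ncOut
reach-block (w , bs , (α₁ , β₁ , f₁ , g₁ , refl) , (α₂ , β₂ , f₂ , g₂ , refl) ,
                      (α₃ , β₃ , f₃ , g₃ , refl) , (α₄ , β₄ , f₄ , g₄ , refl)) =
  retarget (sym (cong₄ (openSuffix-snoc w α₁ β₁ _) (openSuffix-snoc w α₂ β₂ _)
                       (openSuffix-snoc w α₃ β₃ _) (openSuffix-snoc w α₄ β₄ _)))
    (via (# 34) ⨾ via (# 0) ⨾ prefix-loop (f₁ , f₂ , f₃ , f₄) ⨾ via (# 1) ⨾
     via (# 14) ⨾ code-loop bs ⨾ via (# 15) ⨾
     via (# 18) ⨾ suffix-loop (g₁ , g₂ , g₃ , g₄) ⨾ via (# 19) ⨾ via (# 32))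

reach-blocks : ∀ {Q} → All SharesCode Q → Reachable ncOut ─[ concatFramed Q ]→ Reachable ncOut
reach-blocks []       = stay
reach-blocks (s ∷ ss) = reach-block s ⨾ reach-blocks ss

Blocks⇒generates : ∀ {x} → Blocks (straighten x) → Generates CC x
Blocks⇒generates (Q , ss , eq) with apply (reach-blocks ss ⨾ via (# 35)) reach-start
... | t , e , t-in , t-out , t-tuple =
  t , (e , t-in , t-out) , straighten-injective (trans t-tuple (trans (⊕-identityʳ (concatFramed Q)) (sym eq)))

generates⇔Blocks : ∀ x → Generates CC x ⇔ Blocks (straighten x)
generates⇔Blocks x = mk⇔ generates⇒Blocks Blocks⇒generates

-- Symmetries of the block language

SharesCode-rotate : ∀ {q} → SharesCode q → SharesCode (rotate q)
SharesCode-rotate (w , bs , o₁ , o₂ , o₃ , o₄) = w , bs , o₄ , o₁ , o₂ , o₃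

concatFramed-rotate : ∀ Q → concatFramed (map rotate Q) ≡ rotate (concatFramed Q)
concatFramed-rotate []                      = refl
concatFramed-rotate (q@(_ , _ , _ , _) ∷ Q) = cong (map₄ framed (rotate q) ⊕_) (concatFramed-rotate Q)

Blocks-rotate : ∀ {y} → Blocks y → Blocks (rotate y)
Blocks-rotate (Q , ss , refl) =
  map rotate Q , All.map⁺ (All.map SharesCode-rotate ss) , sym (concatFramed-rotate Q)

Blocks-rotate⇔ : ∀ y → Blocks y ⇔ Blocks (rotate y)
Blocks-rotate⇔ y = mk⇔ Blocks-rotate (Blocks-rotate ∘ Blocks-rotate ∘ Blocks-rotate)

All-reverse : ∀ {A : Set} {P : A → Set} {xs} → All P xs → All P (reverse xs)
All-reverse ps = All.tabulate λ x∈ → All.lookup ps (Any.reverse⁻ x∈)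

reverse-∷-++ : ∀ {A : Set} (x : A) xs ys → reverse (x ∷ xs) ++ ys ≡ reverse xs ++ x ∷ ys
reverse-∷-++ x xs ys = trans (sym (ʳ++-defn (x ∷ xs))) (ʳ++-defn xs)

reverse-occurrence : ∀ α w β →
  reverse (α ++ dollar ∷ w ++ dollar ∷ β) ≡ reverse β ++ dollar ∷ reverse w ++ dollar ∷ reverse α
reverse-occurrence α w β = begin
  reverse (α ++ dollar ∷ w ++ dollar ∷ β)                   ≡⟨ reverse-++ α _ ⟩
  reverse (dollar ∷ w ++ dollar ∷ β) ++ reverse α           ≡⟨ reverse-∷-++ dollar (w ++ dollar ∷ β) _ ⟩
  reverse (w ++ dollar ∷ β) ++ dollar ∷ reverse α           ≡⟨ cong (_++ dollar ∷ reverse α) (reverse-++ w _) ⟩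
  (reverse (dollar ∷ β) ++ reverse w) ++ dollar ∷ reverse α ≡⟨ ++-assoc (reverse (dollar ∷ β)) _ _ ⟩
  reverse (dollar ∷ β) ++ reverse w ++ dollar ∷ reverse α   ≡⟨ reverse-∷-++ dollar β _ ⟩
  reverse β ++ dollar ∷ reverse w ++ dollar ∷ reverse α     ∎
  where open ≡-Reasoning

Occurs-reverse : ∀ {w x} → Occurs w x → Occurs (reverse w) (reverse x)
Occurs-reverse {w} (α , β , fα , fβ , refl) =
  reverse β , reverse α , All-reverse fβ , All-reverse fα , reverse-occurrence α w β

SharesCode-reverse₄ : ∀ {q} → SharesCode q → SharesCode (reverse₄ q)
SharesCode-reverse₄ (w , bs , o₁ , o₂ , o₃ , o₄) =
  reverse w , All-reverse bs , Occurs-reverse o₁ , Occurs-reverse o₂ , Occurs-reverse o₃ , Occurs-reverse o₄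

reverse-framed : ∀ x → reverse (framed x) ≡ framed (reverse x)
reverse-framed x = trans (unfold-reverse hash (x ++ [ hash ])) (cong (_∷ʳ hash) (reverse-++ x [ hash ]))

concatFramed-reverse : ∀ Q → concatFramed (reverse (map reverse₄ Q)) ≡ reverse₄ (concatFramed Q)
concatFramed-reverse []                           = refl
concatFramed-reverse (q@(q₁ , q₂ , q₃ , q₄) ∷ Q) = begin
  concatFramed (reverse (reverse₄ q ∷ map reverse₄ Q))
    ≡⟨ cong concatFramed (unfold-reverse (reverse₄ q) (map reverse₄ Q)) ⟩
  concatFramed (reverse (map reverse₄ Q) ++ [ reverse₄ q ])
    ≡⟨ concatFramed-++ (reverse (map reverse₄ Q)) [ reverse₄ q ] ⟩
  concatFramed (reverse (map reverse₄ Q)) ⊕ map₄ framed (reverse₄ q) ⊕ ε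
    ≡⟨ cong₂ _⊕_ (concatFramed-reverse Q) (⊕-identityʳ (map₄ framed (reverse₄ q))) ⟩
  reverse₄ (concatFramed Q) ⊕ map₄ framed (reverse₄ q)
    ≡⟨ cong (reverse₄ (concatFramed Q) ⊕_)
            (sym (cong₄ (reverse-framed q₁) (reverse-framed q₂) (reverse-framed q₃) (reverse-framed q₄))) ⟩
  reverse₄ (concatFramed Q) ⊕ reverse₄ (map₄ framed q)
    ≡⟨ reverse₄-⊕ (map₄ framed q) (concatFramed Q) ⟨
  reverse₄ (map₄ framed q ⊕ concatFramed Q) ∎
  where open ≡-Reasoning

Blocks-reverse₄ : ∀ {y} → Blocks y → Blocks (reverse₄ y)
Blocks-reverse₄ (Q , ss , refl) =
  reverse (map reverse₄ Q) , All-reverse (All.map⁺ (All.map SharesCode-reverse₄ ss)) , sym (concatFramed-reverse Q)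

Blocks-reverse₄⇔ : ∀ y → Blocks (reverse₄ y) ⇔ Blocks y
Blocks-reverse₄⇔ y = mk⇔ (subst Blocks (reverse₄-involutive y) ∘ Blocks-reverse₄) Blocks-reverse₄

-- Parsing concatenations of framed words

Avoids : ∀ {A : Set} → A → List A → Set
Avoids s = All (_≢ s)

delimited-unique : ∀ {A : Set} {s : A} x y {r r′} → Avoids s x → Avoids s y →
                   x ++ s ∷ r ≡ y ++ s ∷ r′ → x ≡ y × r ≡ r′
delimited-unique []      []      _        _        eq = refl , proj₂ (∷-injective eq)
delimited-unique []      (_ ∷ _) _        (s≢ ∷ _) eq = ⊥-elim (s≢ (sym (proj₁ (∷-injective eq))))
delimited-unique (_ ∷ _) []      (s≢ ∷ _) _        eq = ⊥-elim (s≢ (proj₁ (∷-injective eq)))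
delimited-unique (a ∷ x) (b ∷ y) (_ ∷ x≢) (_ ∷ y≢) eq with ∷-injective eq
... | refl , eq′ with delimited-unique x y x≢ y≢ eq′
... | refl , r≡ = refl , r≡

delimited-split : ∀ {A : Set} {s : A} x y {r r′} → Avoids s x → x ++ s ∷ r ≡ y ++ s ∷ r′ →
                  (y ≡ x × r ≡ r′) ⊎ ∃ λ y′ → y ≡ x ++ s ∷ y′ × r ≡ y′ ++ s ∷ r′
delimited-split []      []      _        eq = inj₁ (refl , proj₂ (∷-injective eq))
delimited-split []      (_ ∷ y) _        eq with ∷-injective eq
... | refl , eq′ = inj₂ (y , refl , eq′)
delimited-split (_ ∷ _) []      (s≢ ∷ _) eq = ⊥-elim (s≢ (proj₁ (∷-injective eq)))
delimited-split (a ∷ x) (b ∷ y) (_ ∷ x≢) eq with ∷-injective eq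
... | refl , eq′ with delimited-split x y x≢ eq′
... | inj₁ (refl , r≡)       = inj₁ (refl , r≡)
... | inj₂ (y′ , refl , r≡)  = inj₂ (y′ , refl , r≡)

HashFree : Word → Set
HashFree = Avoids hash

Filler⇒≢hash : ∀ {σ} → Filler σ → σ ≢ hash
Filler⇒≢hash fill0 ()
Filler⇒≢hash fill1 ()
Filler⇒≢hash fill$ ()

Fillers⇒HashFree : ∀ {x} → Fillers x → HashFree x
Fillers⇒HashFree = All.map Filler⇒≢hash

Bit⇒Filler : ∀ {σ} → Bit σ → Filler σ
Bit⇒Filler bit0 = fill0
Bit⇒Filler bit1 = fill1

Occurs-hashFree : ∀ {w x} → Bits w → Occurs w x → HashFree x
Occurs-hashFree bs (_ , _ , fα , fβ , refl) =
  Fillers⇒HashFree (All.++⁺ fα (fill$ ∷ All.++⁺ (All.map Bit⇒Filler bs) (fill$ ∷ fβ)))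

framedAll : List Word → Word
framedAll = concatMap framed

framed-++ : ∀ x r → framed x ++ r ≡ hash ∷ x ++ hash ∷ r
framed-++ x r = cong (hash ∷_) (++-assoc x [ hash ] r)

framedAll-uncons : ∀ {L x r} → All HashFree L → HashFree x → framedAll L ≡ framed x ++ r →
                   ∃ λ L′ → L ≡ x ∷ L′ × framedAll L′ ≡ r
framedAll-uncons {[]}    _          _   ()
framedAll-uncons {l ∷ L} {x} {r} (l# ∷ _) x# eq
  with delimited-unique l x l# x# (∷-injectiveʳ (trans (sym (framed-++ l _)) (trans eq (framed-++ x r))))
... | refl , rest = L , refl , rest

framedAll-[] : ∀ L → framedAll L ≡ [] → L ≡ []
framedAll-[] [] _ = refl

data Zip₄ (R : Tuple → Set) : List Word → List Word → List Word → List Word → Set where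
  []  : Zip₄ R [] [] [] []
  _∷_ : ∀ {a b c d as bs cs ds} → R (a , b , c , d) → Zip₄ R as bs cs ds →
        Zip₄ R (a ∷ as) (b ∷ bs) (c ∷ cs) (d ∷ ds)

Zip₄-++⁺ : ∀ {R A B C D A′ B′ C′ D′} → Zip₄ R A B C D → Zip₄ R A′ B′ C′ D′ →
           Zip₄ R (A ++ A′) (B ++ B′) (C ++ C′) (D ++ D′)
Zip₄-++⁺ []       zs = zs
Zip₄-++⁺ (r ∷ rs) zs = r ∷ Zip₄-++⁺ rs zs

Zip₄-++⁻ : ∀ {R} A B C D {A′ B′ C′ D′} →
           length B ≡ length A → length C ≡ length A → length D ≡ length A →
           Zip₄ R (A ++ A′) (B ++ B′) (C ++ C′) (D ++ D′) → Zip₄ R A B C D × Zip₄ R A′ B′ C′ D′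
Zip₄-++⁻ []      []      []      []      _  _  _  zs       = [] , zs
Zip₄-++⁻ (_ ∷ A) (_ ∷ B) (_ ∷ C) (_ ∷ D) eB eC eD (r ∷ zs) =
  let (xs , ys) = Zip₄-++⁻ A B C D (suc-injective eB) (suc-injective eC) (suc-injective eD) zs
  in r ∷ xs , ys

Blocks⇒Zip₄ : ∀ {L₁ L₂ L₃ L₄} → All HashFree L₁ → All HashFree L₂ → All HashFree L₃ → All HashFree L₄ →
              ∀ {Q} → All SharesCode Q → (framedAll L₁ , framedAll L₂ , framedAll L₃ , framedAll L₄) ≡ concatFramed Q →
              Zip₄ SharesCode L₁ L₂ L₃ L₄
Blocks⇒Zip₄ {L₁} {L₂} {L₃} {L₄} _ _ _ _ [] eq
  with ,-injective₄ eq
... | e₁ , e₂ , e₃ , e₄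
  with framedAll-[] L₁ e₁ | framedAll-[] L₂ e₂ | framedAll-[] L₃ e₃ | framedAll-[] L₄ e₄
... | refl | refl | refl | refl = []
Blocks⇒Zip₄ h₁ h₂ h₃ h₄ (s@(w , bs , o₁ , o₂ , o₃ , o₄) ∷ ss) eq
  with ,-injective₄ eq
... | e₁ , e₂ , e₃ , e₄
  with framedAll-uncons h₁ (Occurs-hashFree bs o₁) e₁ | framedAll-uncons h₂ (Occurs-hashFree bs o₂) e₂
     | framedAll-uncons h₃ (Occurs-hashFree bs o₃) e₃ | framedAll-uncons h₄ (Occurs-hashFree bs o₄) e₄
... | _ , refl , r₁ | _ , refl , r₂ | _ , refl , r₃ | _ , refl , r₄ =
  s ∷ Blocks⇒Zip₄ (All.tail h₁) (All.tail h₂) (All.tail h₃) (All.tail h₄) ss (cong₄ r₁ r₂ r₃ r₄)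

Zip₄⇒Blocks : ∀ {L₁ L₂ L₃ L₄} → Zip₄ SharesCode L₁ L₂ L₃ L₄ →
              Blocks (framedAll L₁ , framedAll L₂ , framedAll L₃ , framedAll L₄)
Zip₄⇒Blocks []       = [] , [] , refl
Zip₄⇒Blocks {a ∷ _} {b ∷ _} {c ∷ _} {d ∷ _} (s ∷ zs) =
  let (Q , ss , eq) = Zip₄⇒Blocks zs
  in (a , b , c , d) ∷ Q , s ∷ ss , cong (map₄ framed (a , b , c , d) ⊕_) eq

Blocks⇔Zip₄ : ∀ {L₁ L₂ L₃ L₄} → All HashFree L₁ → All HashFree L₂ → All HashFree L₃ → All HashFree L₄ →
              Blocks (framedAll L₁ , framedAll L₂ , framedAll L₃ , framedAll L₄) ⇔ Zip₄ SharesCode L₁ L₂ L₃ L₄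
Blocks⇔Zip₄ h₁ h₂ h₃ h₄ = mk⇔ (λ (_ , ss , eq) → Blocks⇒Zip₄ h₁ h₂ h₃ h₄ ss eq) Zip₄⇒Blocks

-- Binary codes of vertices

bitValue : Sym → ℕ
bitValue s1 = 1
bitValue _  = 0

fromBits : Word → ℕ
fromBits = foldl (λ acc σ → acc * 2 + bitValue σ) 0

-- The bit binFuel appends for remainder m, so that binFuel unfolds to it.
parityBit : ℕ → Sym
parityBit m = if does (m ≟ 0) then s0 else s1

parityBit-bit : ∀ m → Bit (parityBit m)
parityBit-bit zero    = bit0
parityBit-bit (suc _) = bit1

bitValue-parityBit : ∀ m → m < 2 → bitValue (parityBit m) ≡ m
bitValue-parityBit 0 _ = refl
bitValue-parityBit 1 _ = refl
bitValue-parityBit (suc (suc _)) (s≤s (s≤s ()))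

binFuel-bits : ∀ f m → Bits (binFuel f m)
binFuel-bits zero    _       = []
binFuel-bits (suc f) zero    = []
binFuel-bits (suc f) (suc m) = All.++⁺ (binFuel-bits f _) (parityBit-bit (suc m % 2) ∷ [])

fromBits-binFuel : ∀ f m → m ≤ f → fromBits (binFuel f m) ≡ m
fromBits-binFuel zero    zero    _ = refl
fromBits-binFuel (suc f) zero    _ = refl
fromBits-binFuel (suc f) (suc m) (s≤s m≤f) = begin
  fromBits (binFuel f (suc m / 2) ++ [ parityBit (suc m % 2) ])
    ≡⟨ foldl-++ _ 0 (binFuel f (suc m / 2)) _ ⟩
  fromBits (binFuel f (suc m / 2)) * 2 + bitValue (parityBit (suc m % 2))
    ≡⟨ cong₂ (λ q r → q * 2 + r) (fromBits-binFuel f (suc m / 2) half≤f) (bitValue-parityBit _ (m%n<n (suc m) 2)) ⟩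
  suc m / 2 * 2 + suc m % 2
    ≡⟨ +-comm (suc m / 2 * 2) (suc m % 2) ⟩
  suc m % 2 + suc m / 2 * 2
    ≡⟨ m≡m%n+[m/n]*n (suc m) 2 ⟨
  suc m ∎
  where
  open ≡-Reasoning
  half≤f : suc m / 2 ≤ f
  half≤f = ≤-trans (≤-pred (m/n<m (suc m) 2 (s≤s (s≤s z≤n)))) m≤f

vbar-bits : ∀ {n} (v : Fin n) → Bits (vbar v)
vbar-bits v = binFuel-bits (suc (toℕ v)) (suc (toℕ v))

vbar-injective : ∀ {n} {u v : Fin n} → vbar u ≡ vbar v → u ≡ v
vbar-injective {u = u} {v} eq = toℕ-injective (suc-injective (begin
  suc (toℕ u)            ≡⟨ fromBits-binFuel _ _ ≤-refl ⟨
  fromBits (vbar u)      ≡⟨ cong fromBits eq ⟩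
  fromBits (vbar v)      ≡⟨ fromBits-binFuel _ _ ≤-refl ⟩
  suc (toℕ v)            ∎))
  where open ≡-Reasoning

vbar-nonempty : ∀ {n} (v : Fin n) → ∃₂ λ c w → vbar v ≡ c ∷ w
vbar-nonempty v with binFuel (toℕ v) (suc (toℕ v) / 2)
... | []    = _ , _ , refl
... | c ∷ w = c , _ , refl

-- Reading adjacency off the gadgets

Bit⇒≢$ : ∀ {σ} → Bit σ → σ ≢ dollar
Bit⇒≢$ bit0 ()
Bit⇒≢$ bit1 ()

Bits⇒avoids$ : ∀ {w} → Bits w → Avoids dollar w
Bits⇒avoids$ = All.map Bit⇒≢$

vbar-avoids$ : ∀ {n} (v : Fin n) → Avoids dollar (vbar v)
vbar-avoids$ v = Bits⇒avoids$ (vbar-bits v)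

NG-++ : ∀ {n} (u : Fin n) r → NG u ++ r ≡ dollar ∷ vbar u ++ dollar ∷ r
NG-++ u r = cong (dollar ∷_) (++-assoc (vbar u) [ dollar ] r)

[]≢++∷ : ∀ (x : Word) {σ y} → [] ≢ x ++ σ ∷ y
[]≢++∷ []      ()
[]≢++∷ (_ ∷ _) ()

Occurs-NG : ∀ {n} (v : Fin n) {w} → Bits w → Occurs w (NG v) → vbar v ≡ w
Occurs-NG v bs ([] , _ , _ , _ , eq) =
  proj₁ (delimited-unique (vbar v) _ (vbar-avoids$ v) (Bits⇒avoids$ bs) (∷-injectiveʳ eq))
Occurs-NG v bs ((_ ∷ α) , _ , _ , _ , eq) with ∷-injective eq
... | refl , eq′ with delimited-split (vbar v) α (vbar-avoids$ v) eq′
... | inj₁ (_ , eq″)      = ⊥-elim ([]≢++∷ _ eq″)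
... | inj₂ (y , _ , eq″)  = ⊥-elim ([]≢++∷ y eq″)

-- The code must be nonempty: the empty code occurs between any two adjacent NGs.
Occurs-NGs : ∀ {n} (us : List (Fin n)) {α β c w} → Bits (c ∷ w) →
             concatMap NG us ≡ α ++ dollar ∷ (c ∷ w) ++ dollar ∷ β → ∃ λ u → u ∈ us × vbar u ≡ c ∷ w
Occurs-NGs []       {[]}    _ ()
Occurs-NGs []       {_ ∷ _} _ ()
Occurs-NGs (u ∷ us) {[]}    bs eq =
  u , here refl ,
  proj₁ (delimited-unique (vbar u) _ (vbar-avoids$ u) (Bits⇒avoids$ bs) (∷-injectiveʳ (trans (sym (NG-++ u _)) eq)))
Occurs-NGs (u ∷ us) {_ ∷ α} bs eq with ∷-injective (trans (sym (NG-++ u _)) eq)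
... | refl , eq′ with delimited-split (vbar u) α (vbar-avoids$ u) eq′
... | inj₂ (α′ , _ , eq″) = let (u′ , u′∈ , code) = Occurs-NGs us bs eq″ in u′ , there u′∈ , code
Occurs-NGs (u ∷ [])       _            _ | _ | inj₁ (_ , ())
Occurs-NGs (u ∷ (u′ ∷ us)) (c-bit ∷ _) _ | _ | inj₁ (_ , eq″) =
  ⊥-elim (Bit⇒≢$ c-bit (sym (∷-injectiveˡ (trans (sym (NG-++ u′ _)) eq″))))

NG-fillers : ∀ {n} (u : Fin n) → Fillers (NG u)
NG-fillers u = fill$ ∷ All.++⁺ (All.map Bit⇒Filler (vbar-bits u)) (fill$ ∷ [])

NGs-fillers : ∀ {n} (us : List (Fin n)) → Fillers (concatMap NG us)
NGs-fillers []       = []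
NGs-fillers (u ∷ us) = All.++⁺ (NG-fillers u) (NGs-fillers us)

cliqueCodes : ∀ {n} → ℕ → List (Fin n) → List Word
cliqueCodes m = concatMap (replicate m ∘ NG)

module _ {n} (G : Graph n) where

  nbhd⇒Adj : ∀ {x u} → u ∈ nbhd G x → Adj G x u
  nbhd⇒Adj {x} u∈ = proj₂ (∈-filter⁻ (λ u → adj G x u ≟ᵇ true) {xs = allFin n} u∈)

  Adj⇒nbhd : ∀ {x u} → Adj G x u → u ∈ nbhd G x
  Adj⇒nbhd {x} {u} a = ∈-filter⁺ (λ u → adj G x u ≟ᵇ true) (∈-allFin u) a

  Occurs-LG⇒ : ∀ x v → Occurs (vbar v) (LG G x) → Adj G x v
  Occurs-LG⇒ x v (α , β , _ , _ , eq) with vbar-nonempty v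
  ... | c , w , code =
    let (u , u∈ , u-code) = Occurs-NGs (nbhd G x) (subst Bits code (vbar-bits v))
                                       (subst (λ z → LG G x ≡ α ++ dollar ∷ z ++ dollar ∷ β) code eq)
    in subst (Adj G x) (vbar-injective (trans u-code (sym code))) (nbhd⇒Adj u∈)

  Occurs-LG⇐ : ∀ x v → Adj G x v → Occurs (vbar v) (LG G x)
  Occurs-LG⇐ x v a with ∈-∃++ (Adj⇒nbhd a)
  ... | ys , zs , eq = concatMap NG ys , concatMap NG zs , NGs-fillers ys , NGs-fillers zs , (begin
    concatMap NG (nbhd G x)                           ≡⟨ cong (concatMap NG) eq ⟩
    concatMap NG (ys ++ v ∷ zs)                       ≡⟨ concatMap-++ NG ys (v ∷ zs) ⟩
    concatMap NG ys ++ NG v ++ concatMap NG zs        ≡⟨ cong (concatMap NG ys ++_) (NG-++ v _) ⟩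
    concatMap NG ys ++ dollar ∷ vbar v ++ dollar ∷ concatMap NG zs ∎)
    where open ≡-Reasoning

  SharesCode-gadgets⇒ : ∀ v x y z → SharesCode (NG v , LG G x , LG G y , LG G z) →
                        Adj G x v × Adj G y v × Adj G z v
  SharesCode-gadgets⇒ v x y z (w , bs , o₁ , o₂ , o₃ , o₄) with Occurs-NG v bs o₁
  ... | refl = Occurs-LG⇒ x v o₂ , Occurs-LG⇒ y v o₃ , Occurs-LG⇒ z v o₄

  SharesCode-gadgets⇐ : ∀ v x y z → Adj G x v → Adj G y v → Adj G z v →
                        SharesCode (NG v , LG G x , LG G y , LG G z)
  SharesCode-gadgets⇐ v x y z a₂ a₃ a₄ =
    vbar v , vbar-bits v , ([] , [] , [] , [] , refl) ,
    Occurs-LG⇐ x v a₂ , Occurs-LG⇐ y v a₃ , Occurs-LG⇐ z v a₄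

  AdjacentToAll : Fin n → List (Fin n) → Set
  AdjacentToAll v = All (λ x → Adj G x v)

  Row : List (Fin n) → List (Fin n) → List (Fin n) → Fin n → Set
  Row C₂ C₃ C₄ v = AdjacentToAll v C₂ × AdjacentToAll v C₃ × AdjacentToAll v C₄

  Zip₄-row⇒ : ∀ v k {C₂ C₃ C₄} →
              Zip₄ SharesCode (replicate k (NG v)) (map (LG G) C₂) (map (LG G) C₃) (map (LG G) C₄) →
              Row C₂ C₃ C₄ v
  Zip₄-row⇒ v zero    {[]}    {[]}    {[]}    []       = [] , [] , []
  Zip₄-row⇒ v (suc k) {x ∷ _} {y ∷ _} {z ∷ _} (s ∷ zs) =
    let (a₂ , a₃ , a₄) = SharesCode-gadgets⇒ v x y z s
        (r₂ , r₃ , r₄) = Zip₄-row⇒ v k zs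
    in a₂ ∷ r₂ , a₃ ∷ r₃ , a₄ ∷ r₄

  Zip₄-row⇐ : ∀ v k {C₂ C₃ C₄} → length C₂ ≡ k → length C₃ ≡ k → length C₄ ≡ k → Row C₂ C₃ C₄ v →
              Zip₄ SharesCode (replicate k (NG v)) (map (LG G) C₂) (map (LG G) C₃) (map (LG G) C₄)
  Zip₄-row⇐ v zero    {[]}    {[]}    {[]}    _  _  _  _ = []
  Zip₄-row⇐ v (suc k) {x ∷ _} {y ∷ _} {z ∷ _} e₂ e₃ e₄ (a₂ ∷ r₂ , a₃ ∷ r₃ , a₄ ∷ r₄) =
    SharesCode-gadgets⇐ v x y z a₂ a₃ a₄ ∷
    Zip₄-row⇐ v k (suc-injective e₂) (suc-injective e₃) (suc-injective e₄) (r₂ , r₃ , r₄)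

  neighbourhoodCodes : ℕ → List (Fin n) → List Word
  neighbourhoodCodes k C = concat (replicate k (map (LG G) C))

  Zip₄-rows⇔ : ∀ {m} C₁ {C₂ C₃ C₄} → length C₂ ≡ m → length C₃ ≡ m → length C₄ ≡ m →
    Zip₄ SharesCode (cliqueCodes m C₁) (neighbourhoodCodes (length C₁) C₂)
                    (neighbourhoodCodes (length C₁) C₃) (neighbourhoodCodes (length C₁) C₄)
    ⇔ All (Row C₂ C₃ C₄) C₁
  Zip₄-rows⇔ {m} C₁ {C₂} {C₃} {C₄} e₂ e₃ e₄ = mk⇔ (to C₁) (from C₁)
    where
    rowLength : ∀ {v} C → length C ≡ m → length (map (LG G) C) ≡ length (replicate m (NG v))
    rowLength C e = trans (length-map (LG G) C) (trans e (sym (length-replicate m)))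

    to : ∀ C₁ → Zip₄ SharesCode (cliqueCodes m C₁) (neighbourhoodCodes (length C₁) C₂)
                                (neighbourhoodCodes (length C₁) C₃) (neighbourhoodCodes (length C₁) C₄) →
         All (Row C₂ C₃ C₄) C₁
    to []       _  = []
    to (v ∷ C₁) zs =
      let (row , rest) = Zip₄-++⁻ (replicate m (NG v)) (map (LG G) C₂) (map (LG G) C₃) (map (LG G) C₄)
                                  (rowLength {v} C₂ e₂) (rowLength {v} C₃ e₃) (rowLength {v} C₄ e₄) zs
      in Zip₄-row⇒ v m row ∷ to C₁ rest

    from : ∀ C₁ → All (Row C₂ C₃ C₄) C₁ →
           Zip₄ SharesCode (cliqueCodes m C₁) (neighbourhoodCodes (length C₁) C₂)
                           (neighbourhoodCodes (length C₁) C₃) (neighbourhoodCodes (length C₁) C₄)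
    from []       []         = []
    from (v ∷ C₁) (row ∷ rows) = Zip₄-++⁺ (Zip₄-row⇐ v m e₂ e₃ e₄ row) (from C₁ rows)

  UnionIs2kClique⇔ : ∀ {C₁ C} → IsCliqueL G C₁ → IsCliqueL G C →
                     UnionIs2kClique G C₁ C ⇔ All (λ v → AdjacentToAll v C) C₁
  UnionIs2kClique⇔ {C₁} {C} clique₁ clique = mk⇔ (to C₁) from
    where
    to : ∀ C₁ → IsCliqueL G (C₁ ++ C) → All (λ v → AdjacentToAll v C) C₁
    to []       _                = []
    to (v ∷ C₁) (edges ∷ clique′) =
      All.map (λ {x} (_ , a) → trans (Graph.sym G x v) a) (All.++⁻ʳ C₁ edges) ∷ to C₁ clique′

    from : All (λ v → AdjacentToAll v C) C₁ → UnionIs2kClique G C₁ C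
    from adjs = AllPairs.++⁺ clique₁ clique (All.map (All.map edge) adjs)
      where
      edge : ∀ {v x} → Adj G x v → v ≢ x × Adj G v x
      edge {v} {x} a = (λ { refl → case trans (sym a) (irrefl G x) of λ () }) , trans (Graph.sym G v x) a

  framedAll-neighbourhoodCodes : ∀ k C → framedAll (neighbourhoodCodes k C) ≡ CLG G k C
  framedAll-neighbourhoodCodes zero    C = refl
  framedAll-neighbourhoodCodes (suc k) C = begin
    framedAll (map (LG G) C ++ neighbourhoodCodes k C)
      ≡⟨ concatMap-++ framed (map (LG G) C) (neighbourhoodCodes k C) ⟩
    framedAll (map (LG G) C) ++ framedAll (neighbourhoodCodes k C)
      ≡⟨ cong₂ _++_ (concatMap-map framed (LG G) C) (framedAll-neighbourhoodCodes k C) ⟩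
    CLG G (suc k) C ∎
    where open ≡-Reasoning

  neighbourhoodCodes-hashFree : ∀ k C → All HashFree (neighbourhoodCodes k C)
  neighbourhoodCodes-hashFree k C =
    All.concat⁺ (All.replicate⁺ k (All.map⁺ (All.universal (λ x → Fillers⇒HashFree (NGs-fillers (nbhd G x))) C)))

framedAll-replicate : ∀ k x → framedAll (replicate k x) ≡ framed x ^^ k
framedAll-replicate zero    x = refl
framedAll-replicate (suc k) x = cong (framed x ++_) (framedAll-replicate k x)

framedAll-cliqueCodes : ∀ {n} k (C : List (Fin n)) → framedAll (cliqueCodes k C) ≡ CNG k C
framedAll-cliqueCodes k []      = refl
framedAll-cliqueCodes k (v ∷ C) = begin
  framedAll (replicate k (NG v) ++ cliqueCodes k C)
    ≡⟨ concatMap-++ framed (replicate k (NG v)) (cliqueCodes k C) ⟩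
  framedAll (replicate k (NG v)) ++ framedAll (cliqueCodes k C)
    ≡⟨ cong₂ _++_ (framedAll-replicate k (NG v)) (framedAll-cliqueCodes k C) ⟩
  CNG k (v ∷ C) ∎
  where open ≡-Reasoning

cliqueCodes-hashFree : ∀ {n} k (C : List (Fin n)) → All HashFree (cliqueCodes k C)
cliqueCodes-hashFree k C =
  All.concat⁺ (All.map⁺ (All.universal (λ v → All.replicate⁺ k (Fillers⇒HashFree (NG-fillers v))) C))

All-Row⇔ : ∀ {n} (G : Graph n) {C₁ C₂ C₃ C₄} →
           All (Row G C₂ C₃ C₄) C₁ ⇔
           (All (λ v → AdjacentToAll G v C₂) C₁ × All (λ v → AdjacentToAll G v C₃) C₁ × All (λ v → AdjacentToAll G v C₄) C₁)
All-Row⇔ G = mk⇔ (λ rows → let (r₂ , r₃₄) = All.unzip rows in r₂ , All.unzip r₃₄)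
                 (λ (r₂ , r₃ , r₄) → All.zip (r₂ , All.zip (r₃ , r₄)))

Blocks-cliques⇔ : ∀ {n} (G : Graph n) {k C₁ C₂ C₃ C₄} →
  IsKClique G k C₁ → IsKClique G k C₂ → IsKClique G k C₃ → IsKClique G k C₄ →
  Blocks (CNG k C₁ , CLG G k C₂ , CLG G k C₃ , CLG G k C₄) ⇔
  (UnionIs2kClique G C₁ C₂ × UnionIs2kClique G C₁ C₃ × UnionIs2kClique G C₁ C₄)
Blocks-cliques⇔ G {C₁ = C₁} {C₂} {C₃} {C₄} (refl , _ , clique₁) (e₂ , _ , clique₂) (e₃ , _ , clique₃) (e₄ , _ , clique₄) =
  begin
    Blocks (CNG k C₁ , CLG G k C₂ , CLG G k C₃ , CLG G k C₄)
      ≡⟨ cong Blocks (cong₄ (framedAll-cliqueCodes k C₁) (framedAll-neighbourhoodCodes G k C₂)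
                            (framedAll-neighbourhoodCodes G k C₃) (framedAll-neighbourhoodCodes G k C₄)) ⟨
    Blocks (framedAll (cliqueCodes k C₁) , framedAll (codes C₂) , framedAll (codes C₃) , framedAll (codes C₄))
      ≈⟨ Blocks⇔Zip₄ (cliqueCodes-hashFree k C₁) (neighbourhoodCodes-hashFree G k C₂)
                     (neighbourhoodCodes-hashFree G k C₃) (neighbourhoodCodes-hashFree G k C₄) ⟩
    Zip₄ SharesCode (cliqueCodes k C₁) (codes C₂) (codes C₃) (codes C₄)
      ≈⟨ Zip₄-rows⇔ G C₁ e₂ e₃ e₄ ⟩
    All (Row G C₂ C₃ C₄) C₁
      ≈⟨ All-Row⇔ G ⟩
    (All (λ v → AdjacentToAll G v C₂) C₁ × All (λ v → AdjacentToAll G v C₃) C₁ × All (λ v → AdjacentToAll G v C₄) C₁)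
      ≈⟨ UnionIs2kClique⇔ G clique₁ clique₂ ×-⇔ UnionIs2kClique⇔ G clique₁ clique₃ ×-⇔ UnionIs2kClique⇔ G clique₁ clique₄ ⟨
    (UnionIs2kClique G C₁ C₂ × UnionIs2kClique G C₁ C₃ × UnionIs2kClique G C₁ C₄)
  ∎
  where
  open SetoidReasoning (⇔-setoid 0ℓ)
  k = length C₁
  codes = neighbourhoodCodes G k

mainTheorem4 : ∀ {n : ℕ} (G : Graph n) (k : ℕ) → 1 ≤ k →
    (C₁ C₂ C₃ C₄ : List (Fin n)) →
    IsKClique G k C₁ → IsKClique G k C₂ → IsKClique G k C₃ → IsKClique G k C₄ →
    let a = CNG k C₁
        b = reverse (CLG G k C₂)
        c = CLG G k C₃
        d = reverse (CLG G k C₄)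
        cond = UnionIs2kClique G C₁ C₂ × UnionIs2kClique G C₁ C₃ × UnionIs2kClique G C₁ C₄
    in (Generates CC (a , b , c , d) ⇔ cond)
     × (Generates CC (b , c , d , a) ⇔ cond)
     × (Generates CC (c , d , a , b) ⇔ cond)
     × (Generates CC (d , a , b , c) ⇔ cond)
mainTheorem4 G k _ C₁ C₂ C₃ C₄ κ₁ κ₂ κ₃ κ₄ = abcd , bcda , cdab , dabc
  where
  open SetoidReasoning (⇔-setoid 0ℓ)
  a = CNG k C₁
  B = CLG G k C₂
  c = CLG G k C₃
  D = CLG G k C₄
  cond = UnionIs2kClique G C₁ C₂ × UnionIs2kClique G C₁ C₃ × UnionIs2kClique G C₁ C₄

  abcd = begin
    Generates CC (a , reverse B , c , reverse D)        ≈⟨ generates⇔Blocks _ ⟩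
    Blocks (straighten (straighten (a , B , c , D)))    ≡⟨ cong Blocks (straighten-involutive _) ⟩
    Blocks (a , B , c , D)                              ≈⟨ Blocks-cliques⇔ G κ₁ κ₂ κ₃ κ₄ ⟩
    cond                                                ∎

  bcda = begin
    Generates CC (reverse B , c , reverse D , a) ≈⟨ generates⇔Blocks _ ⟩
    Blocks (reverse₄ (B , c , D , a))            ≈⟨ Blocks-reverse₄⇔ _ ⟩
    Blocks (B , c , D , a)                       ≈⟨ Blocks-rotate⇔ _ ⟩
    Blocks (a , B , c , D)                       ≈⟨ Blocks-cliques⇔ G κ₁ κ₂ κ₃ κ₄ ⟩
    cond                                         ∎

  cdab = begin
    Generates CC (c , reverse D , a , reverse B)        ≈⟨ generates⇔Blocks _ ⟩
    Blocks (straighten (straighten (c , D , a , B)))    ≡⟨ cong Blocks (straighten-involutive _) ⟩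
    Blocks (c , D , a , B)                              ≈⟨ Blocks-rotate⇔ _ ⟩
    Blocks (B , c , D , a)                              ≈⟨ Blocks-rotate⇔ _ ⟩
    Blocks (a , B , c , D)                              ≈⟨ Blocks-cliques⇔ G κ₁ κ₂ κ₃ κ₄ ⟩
    cond                                                ∎

  dabc = begin
    Generates CC (reverse D , a , reverse B , c) ≈⟨ generates⇔Blocks _ ⟩
    Blocks (reverse₄ (D , a , B , c))            ≈⟨ Blocks-reverse₄⇔ _ ⟩
    Blocks (D , a , B , c)                       ≈⟨ Blocks-rotate⇔ _ ⟩
    Blocks (c , D , a , B)                       ≈⟨ Blocks-rotate⇔ _ ⟩
    Blocks (B , c , D , a)                       ≈⟨ Blocks-rotate⇔ _ ⟩
    Blocks (a , B , c , D)                       ≈⟨ Blocks-cliques⇔ G κ₁ κ₂ κ₃ κ₄ ⟩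
    cond                                         ∎
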